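{- In the table with $4$ rows, for all $s\ge1$, \[\mathcal{I}_4(2s+1)=\tfrac14\,\mathcal{I}_4(s+1)^2+\mathcal{D}(s,2)^2.\]
   Context: $\mathcal{I}_4(n)$ is the number of sequences $(r_1,\dots,r_n)$ with $r_i\in\{1,2,3,4\}$ and $|r_{i+1}-r_i|\le1$ (lattice paths with steps $(1,0),(1,1),(1,-1)$ from the first to the last column of the $4$-row, $n$-column table, staying inside). $\mathcal{D}(s,2)$ is the number of sequences $(r_1,\dots,r_s)$ with $r_i\in\{1,2,3,4\}$, $|r_{i+1}-r_i|\le1$ and $r_s=2$ (paths from any cell of the first column to the cell in column $s$, row $2$). -}

module Defs where

open import Data.Nat using (ℕ; zero; suc; _+_; _∸_; _≤ᵇ_)
open import Data.Bool using (Bool; true; false; _∧_; _∨_)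
open import Data.Fin using (Fin; toℕ)
open import Data.Fin.Properties using (_≟_)
open import Data.Vec using (Vec; []; _∷_)
open import Data.List using (List; []; _∷_; map; concatMap; length; filter; allFin)
open import Relation.Nullary.Decidable using (⌊_⌋)
open import Relation.Unary using (Pred; Decidable)
open import Relation.Nullary using (Dec; yes; no)
open import Data.Bool using (T)
open import Data.Bool.Properties using (T?)

-- A row index in the 4-row table: Fin 4 (rows 1,2,3,4 are 0,1,2,3).
Row : Set
Row = Fin 4

allSeqs : (n : ℕ) → List (Vec Row n)
allSeqs zero = [] ∷ []
allSeqs (suc n) = concatMap (λ r → map (r ∷_) (allSeqs n)) (allFin 4)

dist : ℕ → ℕ → ℕ
dist a b = (a ∸ b) + (b ∸ a)

adj : Row → Row → Bool
adj a b = dist (toℕ a) (toℕ b) ≤ᵇ 1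

valid : {n : ℕ} → Vec Row n → Bool
valid [] = true
valid (a ∷ []) = true
valid (a ∷ b ∷ v) = adj a b ∧ valid (b ∷ v)

lastIs : {n : ℕ} → Row → Vec Row n → Bool
lastIs r [] = false
lastIs r (a ∷ []) = ⌊ a ≟ r ⌋
lastIs r (a ∷ b ∷ v) = lastIs r (b ∷ v)

I₄ : ℕ → ℕ
I₄ n = length (filter (λ v → T? (valid v)) (allSeqs n))

D : ℕ → Row → ℕ
D s j = length (filter (λ v → T? (valid v ∧ lastIs j v)) (allSeqs s))

row2 : Row
row2 = Fin.suc Fin.zero
  where import Data.Fin as Fin

-- Let T be the transfer operator of the strip, (T f)(i) = Σ f(k) over the rows k with |i − k| ≤ 1.
-- Walks of n steps starting at row i number (Tⁿ𝟙)(i), and those ending at row j number (Tⁿδⱼ)(i);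
-- since T is symmetric, D(n + 1, j) = ⟨𝟙, Tⁿδⱼ⟩ = ⟨Tⁿ𝟙, δⱼ⟩ = (Tⁿ𝟙)(j).  On profiles (x, y, y, x)
-- T acts by (x, y) ↦ (x + y, x + 2y), whose iterates from (1, 0) are (F(2n − 1), F(2n)).  Hence
-- I₄(n + 1) = 2 F(2n + 3) and D(s, 2) = F(2s), and the claim follows from the Fibonacci addition
-- formula F(4s + 3) = F(2s + 1)² + F(2s + 2)².

module Submission where

open import Defs
open import Data.Nat using (ℕ; _+_; _*_; _^_; _≥_)
open import Relation.Binary.PropositionalEquality using (_≡_)

open import Data.Bool using (Bool; true; false; _∧_; if_then_else_)
open import Data.Bool.Properties using (T?)
open import Data.Fin as Fin using (Fin; toℕ)
open import Data.Fin.Patterns using (0F; 1F; 2F; 3F)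
open import Data.Fin.Properties using (_≟_)
open import Data.List using (List; []; _∷_; _++_; map; concatMap; length; filter; allFin)
open import Data.List.Properties using (filter-++; length-++)
open import Data.Nat using (zero; suc; _∸_; _≤ᵇ_)
import Data.Nat.ListAction as List
open import Data.Nat.GeneralisedArithmetic using (fold; fold-+)
open import Data.Nat.Properties
  using (+-*-semiring; +-comm; +-suc; +-identityʳ; *-identityʳ; *-zeroʳ)
open import Data.Nat.Tactic.RingSolver using (solve-∀)
open import Data.Vec using (Vec; _∷_)
open import Function using (_∘_)
open import Relation.Binary.PropositionalEquality using (_≗_; refl; sym; trans; cong; cong₂; module ≡-Reasoning)
open import Relation.Nullary.Decidable using (⌊_⌋; yes; no)
open import Algebra.Properties.Semiring.Sum +-*-semiring
  using (sum-syntax; sum-cong-≗; ∑-comm; *-distribˡ-sum; *-distribʳ-sum; sum-replicate-zero)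

open ≡-Reasoning

numberOf : {A : Set} → (A → Bool) → List A → ℕ
numberOf P xs = length (filter (T? ∘ P) xs)

numberOf-++ : {A : Set} (P : A → Bool) (xs ys : List A) →
              numberOf P (xs ++ ys) ≡ numberOf P xs + numberOf P ys
numberOf-++ P xs ys = trans (cong length (filter-++ (T? ∘ P) xs ys)) (length-++ (filter (T? ∘ P) xs))

numberOf-map : {A B : Set} (P : B → Bool) (f : A → B) (xs : List A) →
               numberOf P (map f xs) ≡ numberOf (P ∘ f) xs
numberOf-map P f [] = refl
numberOf-map P f (x ∷ xs) with P (f x)
... | true  = cong suc (numberOf-map P f xs)
... | false = numberOf-map P f xs

numberOf-concatMap : {A B : Set} (P : B → Bool) (f : A → List B) (xs : List A) →
                     numberOf P (concatMap f xs) ≡ List.sum (map (numberOf P ∘ f) xs)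
numberOf-concatMap P f [] = refl
numberOf-concatMap P f (x ∷ xs) =
  trans (numberOf-++ P (f x) (concatMap f xs)) (cong (numberOf P (f x) +_) (numberOf-concatMap P f xs))

numberOf-false : {A : Set} (xs : List A) → numberOf (λ _ → false) xs ≡ 0
numberOf-false [] = refl
numberOf-false (x ∷ xs) = numberOf-false xs

numberOf-allSeqs-suc : ∀ n (P : Vec Row (suc n) → Bool) →
  numberOf P (allSeqs (suc n)) ≡ ∑[ i < 4 ] numberOf (λ v → P (i ∷ v)) (allSeqs n)
numberOf-allSeqs-suc n P = begin
  numberOf P (allSeqs (suc n))
    -- List.sum over allFin 4 and ∑[ i < 4 ] unfold to the same term.
    ≡⟨ numberOf-concatMap P (λ i → map (i ∷_) (allSeqs n)) (allFin 4) ⟩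
  ∑[ i < 4 ] numberOf P (map (i ∷_) (allSeqs n))
    ≡⟨ sum-cong-≗ (λ i → numberOf-map P (i ∷_) (allSeqs n)) ⟩
  ∑[ i < 4 ] numberOf (λ v → P (i ∷ v)) (allSeqs n) ∎

⟨_,_⟩ : ∀ {n} → (Fin n → ℕ) → (Fin n → ℕ) → ℕ
⟨ f , g ⟩ = ∑[ i < _ ] (f i * g i)

indicator : ∀ {n} → Fin n → Fin n → ℕ
indicator j i = if ⌊ i ≟ j ⌋ then 1 else 0

-- Not definitional, since ⌊_⌋ pattern-matches on the decision.
indicator-suc : ∀ {n} (j i : Fin n) → indicator (Fin.suc j) (Fin.suc i) ≡ indicator j i
indicator-suc j i with i ≟ j
... | yes _ = refl
... | no _  = refl

⟨⟩-indicator : ∀ {n} (f : Fin n → ℕ) (j : Fin n) → ⟨ f , indicator j ⟩ ≡ f j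
⟨⟩-indicator {suc n} f 0F = begin
  f 0F * 1 + ∑[ i < n ] (f (Fin.suc i) * 0)
    ≡⟨ cong₂ _+_ (*-identityʳ (f 0F)) (sum-cong-≗ (*-zeroʳ ∘ f ∘ Fin.suc)) ⟩
  f 0F + ∑[ i < n ] 0
    ≡⟨ cong (f 0F +_) (sum-replicate-zero n) ⟩
  f 0F + 0
    ≡⟨ +-identityʳ (f 0F) ⟩
  f 0F ∎
⟨⟩-indicator {suc n} f (Fin.suc j) = begin
  f 0F * 0 + ⟨ f ∘ Fin.suc , indicator (Fin.suc j) ∘ Fin.suc ⟩
    ≡⟨ cong₂ _+_ (*-zeroʳ (f 0F)) (sum-cong-≗ (λ i → cong (f (Fin.suc i) *_) (indicator-suc j i))) ⟩
  ⟨ f ∘ Fin.suc , indicator j ⟩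
    ≡⟨ ⟨⟩-indicator (f ∘ Fin.suc) j ⟩
  f (Fin.suc j) ∎

module _ {n : ℕ} (R : Fin n → Fin n → Bool) where

  neighbourSum : (Fin n → ℕ) → Fin n → ℕ
  neighbourSum f i = ∑[ k < n ] (if R i k then f k else 0)

  neighbourSum-cong : ∀ {f g} → f ≗ g → neighbourSum f ≗ neighbourSum g
  neighbourSum-cong f≗g i = sum-cong-≗ λ k → cong (if R i k then_else 0) (f≗g k)

  module _ (R-sym : ∀ i k → R i k ≡ R k i) where

    neighbourSum-selfAdjoint : ∀ f g → ⟨ neighbourSum f , g ⟩ ≡ ⟨ f , neighbourSum g ⟩
    neighbourSum-selfAdjoint f g = begin
      ∑[ i < n ] (∑[ k < n ] (if R i k then f k else 0) * g i)
        ≡⟨ sum-cong-≗ (λ i → *-distribʳ-sum (g i) (λ k → if R i k then f k else 0)) ⟩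
      ∑[ i < n ] ∑[ k < n ] ((if R i k then f k else 0) * g i)
        ≡⟨ ∑-comm (λ i k → (if R i k then f k else 0) * g i) ⟩
      ∑[ k < n ] ∑[ i < n ] ((if R i k then f k else 0) * g i)
        ≡⟨ sum-cong-≗ (λ k → sum-cong-≗ (λ i → transpose i k)) ⟩
      ∑[ k < n ] ∑[ i < n ] (f k * (if R k i then g i else 0))
        ≡⟨ sum-cong-≗ (λ k → sym (*-distribˡ-sum (f k) (λ i → if R k i then g i else 0))) ⟩
      ∑[ k < n ] (f k * ∑[ i < n ] (if R k i then g i else 0)) ∎
      where
      transpose : ∀ i k → (if R i k then f k else 0) * g i ≡ f k * (if R k i then g i else 0)
      transpose i k rewrite R-sym i k with R k i
      ... | true  = refl
      ... | false = sym (*-zeroʳ (f k))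

    neighbourSum-iterate-selfAdjoint : ∀ m f g →
      ⟨ fold f neighbourSum m , g ⟩ ≡ ⟨ f , fold g neighbourSum m ⟩
    neighbourSum-iterate-selfAdjoint zero f g = refl
    neighbourSum-iterate-selfAdjoint (suc m) f g = begin
      ⟨ neighbourSum (fold f neighbourSum m) , g ⟩  ≡⟨ neighbourSum-selfAdjoint _ g ⟩
      ⟨ fold f neighbourSum m , neighbourSum g ⟩    ≡⟨ neighbourSum-iterate-selfAdjoint m f (neighbourSum g) ⟩
      ⟨ f , fold (neighbourSum g) neighbourSum m ⟩  ≡⟨ cong ⟨ f ,_⟩ (sym (fold-+ g neighbourSum m)) ⟩
      ⟨ f , fold g neighbourSum (m + 1) ⟩           ≡⟨ cong (λ p → ⟨ f , fold g neighbourSum p ⟩) (+-comm m 1) ⟩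
      ⟨ f , fold g neighbourSum (suc m) ⟩           ∎

transfer : (Row → ℕ) → Row → ℕ
transfer = neighbourSum adj

adj-sym : ∀ i k → adj i k ≡ adj k i
adj-sym i k = cong (_≤ᵇ 1) (+-comm (toℕ i ∸ toℕ k) (toℕ k ∸ toℕ i))

-- Walks of n steps (n + 1 entries) starting at row i, and those ending at row j.
walksFrom : ℕ → Row → ℕ
walksFrom n i = numberOf (λ v → valid (i ∷ v)) (allSeqs n)

walksFromTo : ℕ → Row → Row → ℕ
walksFromTo n i j = numberOf (λ v → valid (i ∷ v) ∧ lastIs j (i ∷ v)) (allSeqs n)

walksFrom-suc : ∀ n → walksFrom (suc n) ≗ transfer (walksFrom n)
walksFrom-suc n i = trans (numberOf-allSeqs-suc n _) (sum-cong-≗ firstStep)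
  where
  firstStep : ∀ k → numberOf (λ v → adj i k ∧ valid (k ∷ v)) (allSeqs n)
                  ≡ (if adj i k then walksFrom n k else 0)
  firstStep k with adj i k
  ... | true  = refl
  ... | false = numberOf-false (allSeqs n)

walksFromTo-suc : ∀ n j → (λ i → walksFromTo (suc n) i j) ≗ transfer (λ i → walksFromTo n i j)
walksFromTo-suc n j i = trans (numberOf-allSeqs-suc n _) (sum-cong-≗ firstStep)
  where
  firstStep : ∀ k → numberOf (λ v → (adj i k ∧ valid (k ∷ v)) ∧ lastIs j (k ∷ v)) (allSeqs n)
                  ≡ (if adj i k then walksFromTo n k j else 0)
  firstStep k with adj i k
  ... | true  = refl
  ... | false = numberOf-false (allSeqs n)

walksFrom-iterate : ∀ n → walksFrom n ≗ fold (λ _ → 1) transfer n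
walksFrom-iterate zero i = refl
walksFrom-iterate (suc n) i =
  trans (walksFrom-suc n i) (neighbourSum-cong adj (walksFrom-iterate n) i)

walksFromTo-iterate : ∀ n j → (λ i → walksFromTo n i j) ≗ fold (indicator j) transfer n
walksFromTo-iterate zero j i with i ≟ j
... | yes _ = refl
... | no _  = refl
walksFromTo-iterate (suc n) j i =
  trans (walksFromTo-suc n j i) (neighbourSum-cong adj (walksFromTo-iterate n j) i)

D-suc : ∀ n j → D (suc n) j ≡ walksFrom n j
D-suc n j = begin
  D (suc n) j                      ≡⟨ numberOf-allSeqs-suc n _ ⟩
  ∑[ i < 4 ] walksFromTo n i j     ≡⟨ sum-cong-≗ (walksFromTo-iterate n j) ⟩
  ∑[ i < 4 ] Tⁿδⱼ i                ≡⟨ sum-cong-≗ (λ i → sym (+-identityʳ (Tⁿδⱼ i))) ⟩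
  ⟨ (λ _ → 1) , Tⁿδⱼ ⟩             ≡⟨ sym (neighbourSum-iterate-selfAdjoint adj adj-sym n _ _) ⟩
  ⟨ Tⁿ𝟙 , indicator j ⟩            ≡⟨ ⟨⟩-indicator Tⁿ𝟙 j ⟩
  Tⁿ𝟙 j                            ≡⟨ sym (walksFrom-iterate n j) ⟩
  walksFrom n j                    ∎
  where
  Tⁿδⱼ Tⁿ𝟙 : Row → ℕ
  Tⁿδⱼ = fold (indicator j) transfer n
  Tⁿ𝟙  = fold (λ _ → 1) transfer n

outerInner : ℕ → ℕ → Row → ℕ
outerInner x y 0F = x
outerInner x y 1F = y
outerInner x y 2F = y
outerInner x y 3F = x

transfer-outerInner : ∀ x y → transfer (outerInner x y) ≗ outerInner (x + y) (x + 2 * y)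
transfer-outerInner x y 0F = cong (x +_) (+-identityʳ y)
transfer-outerInner x y 1F = refl
transfer-outerInner x y 2F = thirdRow x y
  where
  thirdRow : ∀ x y → y + (y + (x + 0)) ≡ x + 2 * y
  thirdRow = solve-∀
transfer-outerInner x y 3F = lastRow x y
  where
  lastRow : ∀ x y → y + (x + 0) ≡ x + y
  lastRow = solve-∀

sum-outerInner : ∀ x y → ∑[ i < 4 ] outerInner x y i ≡ 2 * (x + y)
sum-outerInner x y = rowsSum x y
  where
  rowsSum : ∀ x y → x + (y + (y + (x + 0))) ≡ 2 * (x + y)
  rowsSum = solve-∀

-- oddFib n = F(2n − 1) and evenFib n = F(2n), with F(−1) = 1.
oddFib evenFib : ℕ → ℕ
oddFib zero    = 1
oddFib (suc n) = oddFib n + evenFib n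
evenFib zero    = 0
evenFib (suc n) = oddFib n + 2 * evenFib n

oddFib-+ : ∀ p q → oddFib (p + q) ≡ oddFib p * oddFib q + evenFib p * evenFib q
oddFib-+ zero q = base (oddFib q) (evenFib q)
  where
  base : ∀ x y → x ≡ 1 * x + 0 * y
  base = solve-∀
oddFib-+ (suc p) q = begin
  oddFib (suc p + q)  ≡⟨ cong oddFib (sym (+-suc p q)) ⟩
  oddFib (p + suc q)  ≡⟨ oddFib-+ p (suc q) ⟩
  oddFib p * (oddFib q + evenFib q) + evenFib p * (oddFib q + 2 * evenFib q)
    ≡⟨ regroup (oddFib p) (evenFib p) (oddFib q) (evenFib q) ⟩
  (oddFib p + evenFib p) * oddFib q + (oddFib p + 2 * evenFib p) * evenFib q ∎
  where
  regroup : ∀ a b c d → a * (c + d) + b * (c + 2 * d) ≡ (a + b) * c + (a + 2 * b) * d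
  regroup = solve-∀

walksFrom-outerInner : ∀ n → walksFrom n ≗ outerInner (oddFib (suc n)) (evenFib (suc n))
walksFrom-outerInner zero 0F = refl
walksFrom-outerInner zero 1F = refl
walksFrom-outerInner zero 2F = refl
walksFrom-outerInner zero 3F = refl
walksFrom-outerInner (suc n) i = begin
  walksFrom (suc n) i
    ≡⟨ walksFrom-suc n i ⟩
  transfer (walksFrom n) i
    ≡⟨ neighbourSum-cong adj (walksFrom-outerInner n) i ⟩
  transfer (outerInner (oddFib (suc n)) (evenFib (suc n))) i
    ≡⟨ transfer-outerInner (oddFib (suc n)) (evenFib (suc n)) i ⟩
  outerInner (oddFib (2 + n)) (evenFib (2 + n)) i ∎

I₄-suc : ∀ n → I₄ (suc n) ≡ 2 * oddFib (2 + n)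
I₄-suc n = begin
  I₄ (suc n)                ≡⟨ numberOf-allSeqs-suc n valid ⟩
  ∑[ i < 4 ] walksFrom n i  ≡⟨ sum-cong-≗ (walksFrom-outerInner n) ⟩
  ∑[ i < 4 ] outerInner (oddFib (suc n)) (evenFib (suc n)) i
    ≡⟨ sum-outerInner (oddFib (suc n)) (evenFib (suc n)) ⟩
  2 * oddFib (2 + n) ∎

D-row2 : ∀ s → D s row2 ≡ evenFib s
D-row2 zero    = refl
D-row2 (suc n) = trans (D-suc n row2) (walksFrom-outerInner n row2)

proposition4p4 : (s : ℕ) → s ≥ 1 →
    4 * I₄ (2 * s + 1) ≡ I₄ (s + 1) ^ 2 + 4 * (D s row2 ^ 2)
proposition4p4 s _ = begin
  4 * I₄ (2 * s + 1)
    ≡⟨ cong (λ m → 4 * I₄ m) (+-comm (2 * s) 1) ⟩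
  4 * I₄ (1 + 2 * s)
    ≡⟨ cong (4 *_) (I₄-suc (2 * s)) ⟩
  4 * (2 * oddFib (2 + 2 * s))
    ≡⟨ cong (λ m → 4 * (2 * oddFib m)) (twice-suc s) ⟩
  4 * (2 * oddFib (suc s + suc s))
    ≡⟨ cong (λ m → 4 * (2 * m)) (oddFib-+ (suc s) (suc s)) ⟩
  4 * (2 * (oddFib (suc s) * oddFib (suc s) + evenFib (suc s) * evenFib (suc s)))
    ≡⟨ expand (oddFib s) (evenFib s) ⟩
  (2 * oddFib (2 + s)) ^ 2 + 4 * (evenFib s ^ 2)
    ≡⟨ sym (cong₂ (λ a d → a ^ 2 + 4 * (d ^ 2)) (trans (cong I₄ (+-comm s 1)) (I₄-suc s)) (D-row2 s)) ⟩
  I₄ (s + 1) ^ 2 + 4 * (D s row2 ^ 2) ∎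
  where
  twice-suc : ∀ s → 2 + 2 * s ≡ suc s + suc s
  twice-suc = solve-∀
  -- The ring solver does not unfold _^_, so the squares are spelled out.
  expand : ∀ x y → 4 * (2 * ((x + y) * (x + y) + (x + 2 * y) * (x + 2 * y)))
                 ≡ let z = 2 * ((x + y) + (x + 2 * y)) in z * (z * 1) + 4 * (y * (y * 1))
  expand = solve-∀
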